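{- If $G$ is a connected $P_4$-free graph and $G\neq K_2$, then $\gamma(G)=\gamma_{\rm cer}(G)$.
   Context: All graphs are finite and simple. A graph is $P_4$-free if it has no induced subgraph isomorphic to the path $P_4$ on four vertices. A set $D\subseteq V_G$ is a dominating set of $G$ if every vertex of $V_G-D$ is adjacent to at least one vertex of $D$; $\gamma(G)$ is the minimum cardinality of a dominating set. A set $D\subseteq V_G$ is a certified dominating set of $G$ if $D$ is a dominating set of $G$ and every vertex in $D$ has either zero or at least two neighbors in $V_G-D$; $\gamma_{\rm cer}(G)$ is the minimum cardinality of a certified dominating set of $G$. -}

module Defs where

open import Data.Nat using (ℕ; zero; suc; _≤_)
open import Data.Fin using (Fin)
open import Data.Fin.Subset using (Subset; _∈_; _∉_; ∣_∣)
open import Data.Bool using (Bool; true; false; T)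
open import Data.Product using (Σ; ∃; _×_; _,_)
open import Data.Sum using (_⊎_)
open import Data.List using (List; []; _∷_; length; filter)
open import Data.List.Relation.Unary.All using (All)
open import Data.List using () renaming (allFin to allFinL)
open import Relation.Nullary using (¬_)
open import Relation.Nullary.Decidable using (Dec; yes; no; _×-dec_; ¬?)
open import Relation.Binary.PropositionalEquality using (_≡_; _≢_)
import Data.Fin.Subset.Properties as SP

record Graph (n : ℕ) : Set where
  field
    adj   : Fin n → Fin n → Bool
    sym   : ∀ i j → adj i j ≡ adj j i
    irrefl : ∀ i → adj i i ≡ false

open Graph public

module _ {n : ℕ} (G : Graph n) where

  Adj : Fin n → Fin n → Set
  Adj i j = T (adj G i j)

  data Walk : Fin n → Fin n → Set where
    here : ∀ {i} → Walk i i
    step : ∀ {i j k} → Adj i j → Walk j k → Walk i k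

  Connected : Set
  Connected = ∀ i j → Walk i j

  P4Free : Set
  P4Free = ∀ a b c d → Adj a b → Adj b c → Adj c d →
           a ≢ c → b ≢ d → a ≢ d →
           ¬ ( ¬ Adj a c × ¬ Adj b d × ¬ Adj a d )

  IsK2 : Set
  IsK2 = (n ≡ 2) × (∀ i j → i ≢ j → Adj i j)

  Dominating : Subset n → Set
  Dominating D = ∀ v → v ∉ D → Σ (Fin n) λ u → u ∈ D × Adj v u

  outDeg : Subset n → Fin n → ℕ
  outDeg D v = length (filter (λ u → T? (adj G v u) ×-dec ¬? (u SP.∈? D)) (allFinL n))
    where
    T? : (b : Bool) → Dec (T b)
    T? true  = yes _
    T? false = no (λ ())

  Certified : Subset n → Set
  Certified D = Dominating D ×
                (∀ v → v ∈ D → (outDeg D v ≡ 0) ⊎ (2 ≤ outDeg D v))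

  IsDomNumber : ℕ → Set
  IsDomNumber k = (Σ (Subset n) λ D → Dominating D × ∣ D ∣ ≡ k)
                × (∀ D → Dominating D → k ≤ ∣ D ∣)

  IsCerDomNumber : ℕ → Set
  IsCerDomNumber k = (Σ (Subset n) λ D → Certified D × ∣ D ∣ ≡ k)
                   × (∀ D → Certified D → k ≤ ∣ D ∣)

-- In a connected P₄-free graph any two vertices are at distance at most 2. Hence every vertex u
-- lies on an edge uw with every vertex adjacent to u or to w: if x is adjacent to neither, moving w
-- to a common neighbour of u and x strictly shrinks the set of such x. If some vertex is universal,
-- it alone is a minimum dominating set, and it is certified because its degree is 0 or at least 2
-- (G ≠ K₂). Otherwise γ ≥ 2, and a non-neighbour y of u and a non-neighbour c of w close an induced
-- 4-cycle u w y c. One of the pairs {u, w}, {w, c}, {u, y} then has each member adjacent to two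
-- vertices outside the pair, so it is a certified dominating set of size 2.
module Submission where

open import Defs hiding (sym; irrefl)
open import Data.Empty using (⊥; ⊥-elim)
open import Data.Nat using (ℕ; zero; suc; _+_; _≤_; _<_; z≤n; s≤s)
open import Data.Nat.Properties using (≤-trans; ≤-reflexive; ≤-antisym; +-suc; +-monoʳ-≤; n≤1+n; m≤n⇒m≤1+n)
open import Data.Fin using (Fin; zero; suc)
open import Data.Fin.Properties using (_≟_; any?; all?; ¬∀⟶∃¬)
open import Data.Fin.Subset using (Subset; _∈_; _∉_; _⊂_; Nonempty; ∣_∣; ⁅_⁆; _∪_; inside; outside)
open import Data.Fin.Subset.Properties
  using (_∈?_; nonempty?; ∣⁅x⁆∣≡1; x∈⁅x⁆; x∈⁅y⁆⇒x≡y; x≢y⇒x∉⁅y⁆; x∈p∪q⁺; x∈p∪q⁻; p⊆q⇒∣p∣≤∣q∣;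
         x∈p∧x≢y⇒x∈p-y; x∈p⇒∣p-x∣<∣p∣)
open import Data.Fin.Subset.Induction using (⊂-wellFounded)
open import Data.Bool using (true; T)
open import Data.Product using (∃; ∃₂; _×_; _,_; proj₁; proj₂)
open import Data.Sum using (_⊎_; inj₁; inj₂; [_,_])
import Data.Sum as Sum
open import Data.List using (List; length; allFin)
open import Data.List.Membership.Propositional using () renaming (_∈_ to _∈ₗ_)
open import Data.List.Membership.Propositional.Properties using (∈-filter⁺; ∈-allFin; ∈-length)
import Data.List.Relation.Unary.Any as Any
import Data.List.Relation.Unary.All as All
open import Data.List.Properties using (filter-none)
open import Data.Vec using (tabulate; _∷_; [])
open import Data.Vec.Properties using (lookup∘tabulate; []=⇒lookup; lookup⇒[]=)
open import Function using (_∘_)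
open import Induction.WellFounded using (Acc; acc)
open import Relation.Nullary using (¬_; Dec; yes; no; does; contradiction)
open import Relation.Nullary.Decidable using (T?; ¬?; _×-dec_; dec-true; decidable-stable)
open import Relation.Unary using (Decidable)
open import Relation.Binary.PropositionalEquality using (_≡_; _≢_; refl; sym; trans; subst; cong; cong₂; ≢-sym)

x∈xs∧y∈xs∧x≢y⇒2≤length : {A : Set} {xs : List A} {x y : A} → x ∈ₗ xs → y ∈ₗ xs → x ≢ y → 2 ≤ length xs
x∈xs∧y∈xs∧x≢y⇒2≤length (Any.here refl) (Any.here refl) x≢y = contradiction refl x≢y
x∈xs∧y∈xs∧x≢y⇒2≤length (Any.here _) (Any.there y∈) _ = s≤s (∈-length y∈)
x∈xs∧y∈xs∧x≢y⇒2≤length (Any.there x∈) (Any.here _) _ = s≤s (∈-length x∈)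
x∈xs∧y∈xs∧x≢y⇒2≤length (Any.there x∈) (Any.there y∈) x≢y =
  m≤n⇒m≤1+n (x∈xs∧y∈xs∧x≢y⇒2≤length x∈ y∈ x≢y)

module _ {n : ℕ} {P : Fin n → Set} (P? : Decidable P) where

  subset : Subset n
  subset = tabulate (λ x → does (P? x))

  ∈-subset⁺ : ∀ {x} → P x → x ∈ subset
  ∈-subset⁺ {x} px = lookup⇒[]= x subset (trans (lookup∘tabulate _ x) (dec-true (P? x) px))

  ∈-subset⁻ : ∀ {x} → x ∈ subset → P x
  ∈-subset⁻ {x} x∈ = yes⇒P (P? x) (trans (sym (lookup∘tabulate _ x)) ([]=⇒lookup x∈))
    where
    yes⇒P : (p? : Dec (P x)) → does p? ≡ true → P x
    yes⇒P (yes px) _ = px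
    yes⇒P (no _) ()

∣p∪q∣≤∣p∣+∣q∣ : ∀ {n} (p q : Subset n) → ∣ p ∪ q ∣ ≤ ∣ p ∣ + ∣ q ∣
∣p∪q∣≤∣p∣+∣q∣ [] [] = z≤n
∣p∪q∣≤∣p∣+∣q∣ (inside ∷ p) (inside ∷ q) =
  s≤s (≤-trans (∣p∪q∣≤∣p∣+∣q∣ p q) (+-monoʳ-≤ ∣ p ∣ (n≤1+n ∣ q ∣)))
∣p∪q∣≤∣p∣+∣q∣ (inside ∷ p) (outside ∷ q) = s≤s (∣p∪q∣≤∣p∣+∣q∣ p q)
∣p∪q∣≤∣p∣+∣q∣ (outside ∷ p) (inside ∷ q) =
  ≤-trans (s≤s (∣p∪q∣≤∣p∣+∣q∣ p q)) (≤-reflexive (sym (+-suc ∣ p ∣ ∣ q ∣)))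
∣p∪q∣≤∣p∣+∣q∣ (outside ∷ p) (outside ∷ q) = ∣p∪q∣≤∣p∣+∣q∣ p q

x∈p⇒0<∣p∣ : ∀ {n} {p : Subset n} {x} → x ∈ p → 0 < ∣ p ∣
x∈p⇒0<∣p∣ {p = p} {x} x∈p =
  subst (_≤ ∣ p ∣) (∣⁅x⁆∣≡1 x) (p⊆q⇒∣p∣≤∣q∣ (λ y∈ → subst (_∈ p) (sym (x∈⁅y⁆⇒x≡y x y∈)) x∈p))

x∈p∧y∈p∧x≢y⇒2≤∣p∣ : ∀ {n} {p : Subset n} {x y} → x ∈ p → y ∈ p → x ≢ y → 2 ≤ ∣ p ∣
x∈p∧y∈p∧x≢y⇒2≤∣p∣ x∈p y∈p x≢y =
  ≤-trans (s≤s (x∈p⇒0<∣p∣ (x∈p∧x≢y⇒x∈p-y y∈p (≢-sym x≢y)))) (x∈p⇒∣p-x∣<∣p∣ x∈p)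

pair : ∀ {n} → Fin n → Fin n → Subset n
pair a b = ⁅ a ⁆ ∪ ⁅ b ⁆

∣pair∣≤2 : ∀ {n} (a b : Fin n) → ∣ pair a b ∣ ≤ 2
∣pair∣≤2 a b = ≤-trans (∣p∪q∣≤∣p∣+∣q∣ ⁅ a ⁆ ⁅ b ⁆) (≤-reflexive (cong₂ _+_ (∣⁅x⁆∣≡1 a) (∣⁅x⁆∣≡1 b)))

a∈pair : ∀ {n} (a b : Fin n) → a ∈ pair a b
a∈pair a b = x∈p∪q⁺ (inj₁ (x∈⁅x⁆ a))

b∈pair : ∀ {n} (a b : Fin n) → b ∈ pair a b
b∈pair a b = x∈p∪q⁺ (inj₂ (x∈⁅x⁆ b))

x∈pair⇒x≡a⊎x≡b : ∀ {n} {a b x : Fin n} → x ∈ pair a b → x ≡ a ⊎ x ≡ b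
x∈pair⇒x≡a⊎x≡b {a = a} {b} x∈ = Sum.map (x∈⁅y⁆⇒x≡y a) (x∈⁅y⁆⇒x≡y b) (x∈p∪q⁻ ⁅ a ⁆ ⁅ b ⁆ x∈)

x≢a∧x≢b⇒x∉pair : ∀ {n} {a b x : Fin n} → x ≢ a → x ≢ b → x ∉ pair a b
x≢a∧x≢b⇒x∉pair x≢a x≢b x∈ = [ x≢a , x≢b ] (x∈pair⇒x≡a⊎x≡b x∈)

Fin2-cover : ∀ (v i j : Fin 2) → i ≢ j → i ≡ v ⊎ j ≡ v
Fin2-cover _          zero       zero       i≢j = contradiction refl i≢j
Fin2-cover _          (suc zero) (suc zero) i≢j = contradiction refl i≢j
Fin2-cover zero       zero       (suc zero) _ = inj₁ refl
Fin2-cover (suc zero) zero       (suc zero) _ = inj₂ refl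
Fin2-cover zero       (suc zero) zero       _ = inj₂ refl
Fin2-cover (suc zero) (suc zero) zero       _ = inj₁ refl

singleton⊎pair⊎twoOthers : ∀ {n} (v : Fin n) →
  (∀ x → x ≡ v) ⊎ (n ≡ 2 × (∀ i j → i ≢ j → i ≡ v ⊎ j ≡ v)) ⊎ (∃₂ λ a b → a ≢ b × a ≢ v × b ≢ v)
singleton⊎pair⊎twoOthers {1} zero = inj₁ λ { zero → refl }
singleton⊎pair⊎twoOthers {2} v = inj₂ (inj₁ (refl , Fin2-cover v))
singleton⊎pair⊎twoOthers {suc (suc (suc _))} zero =
  inj₂ (inj₂ (suc zero , suc (suc zero) , (λ ()) , (λ ()) , (λ ())))
singleton⊎pair⊎twoOthers {suc (suc (suc _))} (suc zero) =
  inj₂ (inj₂ (zero , suc (suc zero) , (λ ()) , (λ ()) , (λ ())))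
singleton⊎pair⊎twoOthers {suc (suc (suc _))} (suc (suc _)) =
  inj₂ (inj₂ (zero , suc zero , (λ ()) , (λ ()) , (λ ())))

module Domination {n : ℕ} (G : Graph n) where

  infix 4 _~_ _~?_

  _~_ : Fin n → Fin n → Set
  _~_ = Adj G

  _~?_ : ∀ x y → Dec (x ~ y)
  x ~? y = T? (adj G x y)

  ~-sym : ∀ {x y} → x ~ y → y ~ x
  ~-sym {x} {y} = subst T (Graph.sym G x y)

  ~-irrefl : ∀ {x} → ¬ x ~ x
  ~-irrefl {x} = subst T (Graph.irrefl G x)

  ~⇒≢ : ∀ {x y} → x ~ y → x ≢ y
  ~⇒≢ xy refl = ~-irrefl xy

  ~-stable : ∀ {x y} → ¬ ¬ x ~ y → x ~ y
  ~-stable {x} {y} = decidable-stable (x ~? y)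

  neighbours⊆⊎extraNeighbour : ∀ x p q → (∀ a → x ~ a → a ≡ p ⊎ a ≡ q) ⊎ ∃ λ a → x ~ a × a ≢ p × a ≢ q
  neighbours⊆⊎extraNeighbour x p q with any? (λ a → x ~? a ×-dec ¬? (a ≟ p) ×-dec ¬? (a ≟ q))
  ... | yes extra = inj₂ extra
  ... | no noExtra = inj₁ neighbours⊆
    where
    neighbours⊆ : ∀ a → x ~ a → a ≡ p ⊎ a ≡ q
    neighbours⊆ a xa with a ≟ p | a ≟ q
    ... | yes a≡p | _ = inj₁ a≡p
    ... | no _ | yes a≡q = inj₂ a≡q
    ... | no a≢p | no a≢q = contradiction (a , xa , a≢p , a≢q) noExtra

  Universal : Fin n → Set
  Universal v = ∀ x → x ≢ v → v ~ x

  NonUniversal : Fin n → Set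
  NonUniversal v = ∃ λ x → x ≢ v × ¬ v ~ x

  nonUniversal? : ∀ v → Dec (NonUniversal v)
  nonUniversal? v = any? (λ x → ¬? (x ≟ v) ×-dec ¬? (v ~? x))

  universal⊎allNonUniversal : ∃ Universal ⊎ (∀ v → NonUniversal v)
  universal⊎allNonUniversal with all? nonUniversal?
  ... | yes allNonUniversal = inj₂ allNonUniversal
  ... | no ¬allNonUniversal with ¬∀⟶∃¬ n NonUniversal nonUniversal? ¬allNonUniversal
  ...   | v , ¬nonUniversal = inj₁ (v , λ x x≢v → ~-stable λ ¬vx → ¬nonUniversal (x , x≢v , ¬vx))

  outDeg≡0 : ∀ D v → (∀ x → v ~ x → x ∈ D) → outDeg G D v ≡ 0
  outDeg≡0 D v N[v]⊆D =
    cong length (filter-none _ {allFin n} (All.tabulate λ _ (vx , x∉D) → x∉D (N[v]⊆D _ vx)))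

  outDeg≥2 : ∀ {D v a b} → a ≢ b → v ~ a → a ∉ D → v ~ b → b ∉ D → 2 ≤ outDeg G D v
  outDeg≥2 a≢b va a∉D vb b∉D =
    x∈xs∧y∈xs∧x≢y⇒2≤length (∈-filter⁺ _ (∈-allFin _) (va , a∉D)) (∈-filter⁺ _ (∈-allFin _) (vb , b∉D))
                           a≢b

  dominating⇒nonempty : Fin n → ∀ {D} → Dominating G D → Nonempty D
  dominating⇒nonempty x {D} dominating with x ∈? D
  ... | yes x∈D = x , x∈D
  ... | no x∉D with dominating x x∉D
  ...   | u , u∈D , _ = u , u∈D

  certified-pair : ∀ {a b} → (∀ v → v ≢ a → v ≢ b → v ~ a ⊎ v ~ b) →
                   2 ≤ outDeg G (pair a b) a → 2 ≤ outDeg G (pair a b) b → Certified G (pair a b)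
  certified-pair {a} {b} dominates a-certified b-certified = dominating , certified
    where
    dominating : Dominating G (pair a b)
    dominating v v∉ with dominates v (λ { refl → v∉ (a∈pair a b) }) (λ { refl → v∉ (b∈pair a b) })
    ... | inj₁ va = a , a∈pair a b , va
    ... | inj₂ vb = b , b∈pair a b , vb
    certified : ∀ v → v ∈ pair a b → outDeg G (pair a b) v ≡ 0 ⊎ 2 ≤ outDeg G (pair a b) v
    certified v v∈ with x∈pair⇒x≡a⊎x≡b v∈
    ... | inj₁ refl = inj₂ a-certified
    ... | inj₂ refl = inj₂ b-certified

  universal⇒certified : ∀ {v} → ¬ IsK2 G → Universal v → Certified G ⁅ v ⁆
  universal⇒certified {v} ¬K2 universal = dominating , certified
    where
    dominating : Dominating G ⁅ v ⁆
    dominating x x∉ = v , x∈⁅x⁆ v , ~-sym (universal x λ { refl → x∉ (x∈⁅x⁆ v) })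
    certified : ∀ x → x ∈ ⁅ v ⁆ → outDeg G ⁅ v ⁆ x ≡ 0 ⊎ 2 ≤ outDeg G ⁅ v ⁆ x
    certified x x∈ with refl ← x∈⁅y⁆⇒x≡y v x∈ with singleton⊎pair⊎twoOthers v
    ... | inj₁ onlyV = inj₁ (outDeg≡0 ⁅ v ⁆ v λ y _ → subst (_∈ ⁅ v ⁆) (sym (onlyV y)) (x∈⁅x⁆ v))
    ... | inj₂ (inj₁ (n≡2 , cover)) = contradiction (n≡2 , K2) ¬K2
      where
      K2 : ∀ i j → i ≢ j → i ~ j
      K2 i j i≢j = [ (λ { refl → universal j (≢-sym i≢j) }) , (λ { refl → ~-sym (universal i i≢j) }) ]
                     (cover i j i≢j)
    ... | inj₂ (inj₂ (a , b , a≢b , a≢v , b≢v)) =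
      inj₂ (outDeg≥2 a≢b (universal a a≢v) (x≢y⇒x∉⁅y⁆ a≢v) (universal b b≢v) (x≢y⇒x∉⁅y⁆ b≢v))

  CertifiedMinimumDominating : Set
  CertifiedMinimumDominating = ∃ λ C → Certified G C × ∀ D → Dominating G D → ∣ C ∣ ≤ ∣ D ∣

  universal⇒certifiedMinimum : ∀ {v} → ¬ IsK2 G → Universal v → CertifiedMinimumDominating
  universal⇒certifiedMinimum {v} ¬K2 universal =
    ⁅ v ⁆ , universal⇒certified ¬K2 universal ,
    λ D dominating → subst (_≤ ∣ D ∣) (sym (∣⁅x⁆∣≡1 v)) (x∈p⇒0<∣p∣ (proj₂ (dominating⇒nonempty v dominating)))

  nonUniversal⇒2≤∣D∣ : (∀ v → NonUniversal v) → Fin n → ∀ {D} → Dominating G D → 2 ≤ ∣ D ∣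
  nonUniversal⇒2≤∣D∣ nonUniversal x₀ {D} dominating with dominating⇒nonempty x₀ dominating
  ... | x , x∈D with nonUniversal x
  ...   | y , y≢x , ¬xy with y ∈? D
  ...     | yes y∈D = x∈p∧y∈p∧x≢y⇒2≤∣p∣ x∈D y∈D (≢-sym y≢x)
  ...     | no y∉D with dominating y y∉D
  ...       | z , z∈D , yz = x∈p∧y∈p∧x≢y⇒2≤∣p∣ x∈D z∈D λ { refl → ¬xy (~-sym yz) }

  γ≡γcer : CertifiedMinimumDominating → ∀ {k m} → IsDomNumber G k → IsCerDomNumber G m → k ≡ m
  γ≡γcer (C , C-certified , C-minimum) {k} ((D , D-dominating , ∣D∣≡k) , k-minimum)
         ((E , E-certified , ∣E∣≡m) , m-minimum) =
    ≤-antisym (subst (k ≤_) ∣E∣≡m (k-minimum E (proj₁ E-certified)))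
              (≤-trans (m-minimum C C-certified) (subst (∣ C ∣ ≤_) ∣D∣≡k (C-minimum D D-dominating)))

module ConnectedP4Free {n : ℕ} {G : Graph n} (connected : Connected G) (p4Free : P4Free G) where

  open Domination G

  noInducedP4 : ∀ {a b c d} → a ~ b → b ~ c → c ~ d → ¬ a ~ c → ¬ b ~ d → ¬ a ~ d → ⊥
  noInducedP4 {a} {b} {c} {d} ab bc cd ¬ac ¬bd ¬ad =
    p4Free a b c d ab bc cd (λ { refl → ¬ad cd }) (λ { refl → ¬ad ab }) (λ { refl → ¬ac (~-sym cd) })
      (¬ac , ¬bd , ¬ad)

  CommonNeighbour : Fin n → Fin n → Set
  CommonNeighbour u y = ∃ λ z → u ~ z × z ~ y

  WithinTwo : Fin n → Fin n → Set
  WithinTwo u y = y ≡ u ⊎ u ~ y ⊎ CommonNeighbour u y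

  withinTwo-step : ∀ {u y y′} → WithinTwo u y → y ~ y′ → WithinTwo u y′
  withinTwo-step (inj₁ refl) uy′ = inj₂ (inj₁ uy′)
  withinTwo-step (inj₂ (inj₁ uy)) yy′ = inj₂ (inj₂ (_ , uy , yy′))
  withinTwo-step {u} {y} {y′} (inj₂ (inj₂ (z , uz , zy))) yy′ with u ~? y′ | z ~? y′ | u ~? y
  ... | yes uy′ | _        | _      = inj₂ (inj₁ uy′)
  ... | no _    | yes zy′  | _      = inj₂ (inj₂ (z , uz , zy′))
  ... | no _    | no _     | yes uy = inj₂ (inj₂ (y , uy , yy′))
  ... | no ¬uy′ | no ¬zy′  | no ¬uy = ⊥-elim (noInducedP4 uz zy yy′ ¬uy ¬zy′ ¬uy′)

  walk⇒withinTwo : ∀ {u x y} → Walk G x y → WithinTwo u x → WithinTwo u y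
  walk⇒withinTwo here            withinTwo = withinTwo
  walk⇒withinTwo (step xx′ walk) withinTwo = walk⇒withinTwo walk (withinTwo-step withinTwo xx′)

  commonNeighbour : ∀ {u y} → y ≢ u → ¬ u ~ y → CommonNeighbour u y
  commonNeighbour {u} {y} y≢u ¬uy with walk⇒withinTwo (connected u y) (inj₁ refl)
  ... | inj₁ y≡u           = contradiction y≡u y≢u
  ... | inj₂ (inj₁ uy)     = contradiction uy ¬uy
  ... | inj₂ (inj₂ common) = common

  TotallyDominates : Fin n → Fin n → Set
  TotallyDominates u w = ∀ v → v ~ u ⊎ v ~ w

  ¬~u⇒~w : ∀ {u w v} → TotallyDominates u w → ¬ v ~ u → v ~ w
  ¬~u⇒~w {v = v} total ¬vu = [ (λ vu → contradiction vu ¬vu) , (λ vw → vw) ] (total v)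

  undominated? : ∀ u w x → Dec (¬ x ~ u × ¬ x ~ w)
  undominated? u w x = ¬? (x ~? u) ×-dec ¬? (x ~? w)

  Undominated : Fin n → Fin n → Subset n
  Undominated u w = subset (undominated? u w)

  -- Three forbidden P₄'s: y z u w forces z ~ w, then x w z y forces x ~ y, and then u z y x is induced.
  undominated-persists : ∀ {u w y z x} → u ~ w → ¬ y ~ u → ¬ y ~ w → u ~ z → z ~ y →
                         ¬ x ~ u → ¬ x ~ z → ¬ x ~ w
  undominated-persists {u} {w} {y} {z} {x} uw ¬yu ¬yw uz zy ¬xu ¬xz xw =
    noInducedP4 uz zy yx (¬yu ∘ ~-sym) (¬xz ∘ ~-sym) (¬xu ∘ ~-sym)
    where
    zw : z ~ w
    zw = ~-stable λ ¬zw → noInducedP4 (~-sym zy) (~-sym uz) uw ¬yu ¬zw ¬yw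
    yx : y ~ x
    yx = ~-stable λ ¬yx → noInducedP4 xw (~-sym zw) zy ¬xz (¬yw ∘ ~-sym) (¬yx ∘ ~-sym)

  Undominated-⊂ : ∀ {u w y z} → u ~ w → y ∈ Undominated u w → u ~ z → z ~ y →
                  Undominated u z ⊂ Undominated u w
  Undominated-⊂ {u} {w} {y} {z} uw y∈ uz zy =
    Uz⊆Uw , y , y∈ , λ y∈′ → proj₂ (∈-subset⁻ (undominated? u z) y∈′) (~-sym zy)
    where
    ¬yu×¬yw : ¬ y ~ u × ¬ y ~ w
    ¬yu×¬yw = ∈-subset⁻ (undominated? u w) y∈
    Uz⊆Uw : ∀ {x} → x ∈ Undominated u z → x ∈ Undominated u w
    Uz⊆Uw x∈ with ¬xu , ¬xz ← ∈-subset⁻ (undominated? u z) x∈ =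
      ∈-subset⁺ (undominated? u w)
        (¬xu , undominated-persists uw (proj₁ ¬yu×¬yw) (proj₂ ¬yu×¬yw) uz zy ¬xu ¬xz)

  totallyDominatingNeighbour′ : ∀ {u w} → u ~ w → Acc _⊂_ (Undominated u w) → ∃ (TotallyDominates u)
  totallyDominatingNeighbour′ {u} {w} uw (acc smaller) with nonempty? (Undominated u w)
  ... | no empty = w , dominated
    where
    dominated : TotallyDominates u w
    dominated v with v ~? u | v ~? w
    ... | yes vu | _      = inj₁ vu
    ... | no _   | yes vw = inj₂ vw
    ... | no ¬vu | no ¬vw = contradiction (v , ∈-subset⁺ (undominated? u w) (¬vu , ¬vw)) empty
  ... | yes (y , y∈) with ¬yu , ¬yw ← ∈-subset⁻ (undominated? u w) y∈
                     with z , uz , zy ← commonNeighbour (λ { refl → ¬yw uw }) (¬yu ∘ ~-sym) =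
    totallyDominatingNeighbour′ uz (smaller (Undominated-⊂ uw y∈ uz zy))

  totallyDominatingNeighbour : ∀ {u w} → u ~ w → ∃ (TotallyDominates u)
  totallyDominatingNeighbour uw = totallyDominatingNeighbour′ uw (⊂-wellFounded _)

  record InducedC4 (u w y c : Fin n) : Set where
    field
      u~w : u ~ w
      w~y : w ~ y
      y~c : y ~ c
      c~u : c ~ u
      ¬u~y : ¬ u ~ y
      ¬w~c : ¬ w ~ c
      y≢u : y ≢ u
      c≢w : c ≢ w

  InducedC4-reverse : ∀ {u w y c} → InducedC4 u w y c → InducedC4 w u c y
  InducedC4-reverse C = record
    { u~w = ~-sym u~w ; w~y = ~-sym c~u ; y~c = ~-sym y~c ; c~u = ~-sym w~y
    ; ¬u~y = ¬w~c ; ¬w~c = ¬u~y ; y≢u = c≢w ; c≢w = y≢u }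
    where open InducedC4 C

  module _ {u w y c} (total : TotallyDominates u w) (C : InducedC4 u w y c) where
    open InducedC4 C

    diagonal-certified : (∀ a → u ~ a → a ≡ w ⊎ a ≡ c) → Certified G (pair w c)
    diagonal-certified N[u]⊆wc =
      certified-pair dominates (outDeg≥2 u≢y (~-sym u~w) u∉ w~y y∉) (outDeg≥2 u≢y c~u u∉ (~-sym y~c) y∉)
      where
      u≢y : u ≢ y
      u≢y = ≢-sym y≢u
      u∉ : u ∉ pair w c
      u∉ = x≢a∧x≢b⇒x∉pair (~⇒≢ u~w) (≢-sym (~⇒≢ c~u))
      y∉ : y ∉ pair w c
      y∉ = x≢a∧x≢b⇒x∉pair (≢-sym (~⇒≢ w~y)) (~⇒≢ y~c)
      dominates : ∀ v → v ≢ w → v ≢ c → v ~ w ⊎ v ~ c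
      dominates v v≢w v≢c with total v
      ... | inj₁ vu = ⊥-elim ([ v≢w , v≢c ] (N[u]⊆wc v (~-sym vu)))
      ... | inj₂ vw = inj₁ vw

    edge-certified : ∀ {a d} → u ~ a → a ≢ w → a ≢ c → w ~ d → d ≢ u → d ≢ y → Certified G (pair u w)
    edge-certified ua a≢w a≢c wd d≢u d≢y =
      certified-pair (λ v _ _ → total v)
        (outDeg≥2 (≢-sym a≢c) (~-sym c~u) (x≢a∧x≢b⇒x∉pair (~⇒≢ c~u) c≢w)
                  ua (x≢a∧x≢b⇒x∉pair (≢-sym (~⇒≢ ua)) a≢w))
        (outDeg≥2 (≢-sym d≢y) w~y (x≢a∧x≢b⇒x∉pair y≢u (≢-sym (~⇒≢ w~y)))
                  wd (x≢a∧x≢b⇒x∉pair d≢u (≢-sym (~⇒≢ wd))))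

  InducedC4⇒certifiedPair : ∀ {u w y c} → TotallyDominates u w → InducedC4 u w y c →
                            ∃ λ C → Certified G C × ∣ C ∣ ≤ 2
  InducedC4⇒certifiedPair {u} {w} {y} {c} total C
    with neighbours⊆⊎extraNeighbour u w c | neighbours⊆⊎extraNeighbour w u y
  ... | inj₁ N[u]⊆wc | _ = _ , diagonal-certified total C N[u]⊆wc , ∣pair∣≤2 w c
  ... | _ | inj₁ N[w]⊆uy =
    _ , diagonal-certified (Sum.swap ∘ total) (InducedC4-reverse C) N[w]⊆uy , ∣pair∣≤2 u y
  ... | inj₂ (a , ua , a≢w , a≢c) | inj₂ (d , wd , d≢u , d≢y) =
    _ , edge-certified total C ua a≢w a≢c wd d≢u d≢y , ∣pair∣≤2 u w

  nonUniversal⇒certifiedPair : (∀ v → NonUniversal v) → Fin n → ∃ λ C → Certified G C × ∣ C ∣ ≤ 2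
  nonUniversal⇒certifiedPair nonUniversal u
    with y , y≢u , ¬uy ← nonUniversal u
    with _ , uz , _ ← commonNeighbour y≢u ¬uy
    with w , total ← totallyDominatingNeighbour uz
    with c , c≢w , ¬wc ← nonUniversal w =
    InducedC4⇒certifiedPair total record
      { u~w = u~w ; w~y = w~y ; y~c = y~c ; c~u = c~u
      ; ¬u~y = ¬uy ; ¬w~c = ¬wc ; y≢u = y≢u ; c≢w = c≢w }
    where
    u~w : u ~ w
    u~w = ¬~u⇒~w total ~-irrefl
    w~y : w ~ y
    w~y = ~-sym (¬~u⇒~w total (¬uy ∘ ~-sym))
    c~u : c ~ u
    c~u = ¬~u⇒~w (Sum.swap ∘ total) (¬wc ∘ ~-sym)
    y~c : y ~ c
    y~c = ~-stable λ ¬yc → noInducedP4 (~-sym w~y) (~-sym u~w) (~-sym c~u) (¬uy ∘ ~-sym) ¬wc ¬yc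

  certifiedMinimum : ¬ IsK2 G → Fin n → CertifiedMinimumDominating
  certifiedMinimum ¬K2 x₀ with universal⊎allNonUniversal
  ... | inj₁ (_ , universal) = universal⇒certifiedMinimum ¬K2 universal
  ... | inj₂ nonUniversal with C , C-certified , ∣C∣≤2 ← nonUniversal⇒certifiedPair nonUniversal x₀ =
    C , C-certified , λ D dominating → ≤-trans ∣C∣≤2 (nonUniversal⇒2≤∣D∣ nonUniversal x₀ dominating)

certifiedMinimumDominating : ∀ {n} (G : Graph n) → Connected G → P4Free G → ¬ IsK2 G →
                             Domination.CertifiedMinimumDominating G
certifiedMinimumDominating {zero}  _ _         _      _   = [] , ((λ ()) , (λ ())) , λ _ _ → z≤n
certifiedMinimumDominating {suc _} G connected p4Free ¬K2 =
  ConnectedP4Free.certifiedMinimum connected p4Free ¬K2 zero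

theorem2p7 : (n : ℕ) (G : Graph n) → Connected G → P4Free G → ¬ IsK2 G →
             (k m : ℕ) → IsDomNumber G k → IsCerDomNumber G m → k ≡ m
theorem2p7 n G connected p4Free ¬K2 k m =
  Domination.γ≡γcer G (certifiedMinimumDominating G connected p4Free ¬K2)
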